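{- Let $S$ be a natural monoid and let $u\in S$ be fully castlable. Then $\Omega(u)=\Omega_\ddagger(u)$.
   Context: Integral monoid: $G$ countable group, $G\ne\{1\}$, $S\subseteq G$ submonoid with (I) $S\cap S^{ -1}=\{1\}$; (II) every $u\in G$ is $u=xy^{ -1}$ ($x,y\in S$) with: whenever $u=zw^{ -1}$, $z,w\in S$, there is $c\in S$ with $z=xc,w=yc$; (III) each $u\in S$ has finitely many factorizations in $S$. $u\mid w$ iff $w\in uS$; $v\ddagger w$ iff $w\in Sv$. $\mathrm{lcm}[u,v]$ is the $w$ with $uS\cap vS=wS$; $\gcd(u,v)$ the lcm of common divisors. $\tau(z)=\#\{(z_1,z_2):z=z_1z_2\}$, $\mathcal P=\{p:\tau(p)=2\}$ (primes). $\mathfrak C_1=\{(u,u^{ -1}\mathrm{lcm}[u,v]):\gcd(u,v)=1\}$, $\Gamma_1=\{((u,u^{ -1}\mathrm{lcm}[u,v]),(v,v^{ -1}\mathrm{lcm}[u,v])):\gcd(u,v)=1\}$. $\mathfrak C\subseteq S\times S$, $\Gamma\subseteq\mathfrak C\times\mathfrak C$ are the smallest sets with: $\Gamma_1\subseteq\Gamma$, $\mathfrak C_1\subseteq\mathfrak C$; $((p,p),(p,p))\in\Gamma$, $p\in\mathcal P$; if $u_1,u_2\ne1$, $((u_2,v),(\tilde v,\tilde u_2))\in\Gamma$, $((u_1,\tilde v),(\tilde{\tilde v},\tilde u_1))\in\Gamma$ then $((u_1u_2,v),(\tilde{\tilde v},\tilde u_1\tilde u_2))\in\Gamma$; if $v_1,v_2\ne1$,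 $((u,v_1),(\tilde v_1,\tilde u))\in\Gamma$, $((\tilde u,v_2),(\tilde v_2,\tilde{\tilde u}))\in\Gamma$ then $((u,v_1v_2),(\tilde v_1\tilde v_2,\tilde{\tilde u}))\in\Gamma$ (pairs occurring lie in $\mathfrak C$). Castlable: integral and $\Gamma$ is the graph of a map $\eta:\mathfrak C\to\mathfrak C$. Natural: castlable and (Axiom V) whenever $p,q\in\mathcal P$, $k,l\ge0$, $(p^k,q^l)\in\mathfrak C$, then $\eta(p^k,q^l)=(r^l,t^k)$ for some $r,t\in\mathcal P$. $u$ is fully castlable if $(u_2,u_3)\in\mathfrak C$ whenever $u=u_1u_2u_3u_4$ with $u_i\in S$. $\Omega(u)=\sum_{p\in\mathcal P}\max\{m\ge0:p^m\mid u\}$, $\Omega_\ddagger(u)=\sum_{p\in\mathcal P}\max\{m\ge0:p^m\ddagger u\}$. -}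

module Defs where

open import Level using (0ℓ)
open import Data.Nat using (ℕ; zero; suc; _≤_)
open import Data.List using (List; map; length)
open import Data.Nat.ListAction using (sum)
open import Data.List.Membership.Propositional using (_∈_)
open import Data.List.Relation.Unary.All using (All)
open import Data.List.Relation.Unary.Unique.Propositional using (Unique)
open import Data.Product using (Σ; Σ-syntax; ∃; ∃-syntax; _×_; _,_)
open import Data.Sum using (_⊎_)
open import Relation.Binary.PropositionalEquality using (_≡_; _≢_)
open import Relation.Nullary using (¬_)
open import Function.Bundles using (_⇔_)
open import Function.Definitions using (Injective)
open import Algebra.Structures using (IsGroup)

record IntegralMonoid : Set₁ where
  infixl 7 _·_
  field
    G        : Set
    _·_      : G → G → G
    e        : G
    inv      : G → G
    isGroup  : IsGroup _≡_ _·_ e inv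
    countable  : Σ (G → ℕ) (λ f → Injective _≡_ _≡_ f)
    nontrivial : ∃[ g ] (g ≢ e)
    S       : G → Set
    S-e     : S e
    S-·     : ∀ {x y} → S x → S y → S (x · y)
    axI     : ∀ x → S x → S (inv x) → x ≡ e
    axII    : ∀ u → Σ[ x ∈ G ] Σ[ y ∈ G ] (S x × S y × u ≡ x · inv y ×
                (∀ z w → S z → S w → u ≡ z · inv w →
                  Σ[ c ∈ G ] (S c × z ≡ x · c × w ≡ y · c)))
    -- (III) every u ∈ S has finitely many factorizations u = z₁ z₂ in S
    axIII   : ∀ u → S u → Σ[ L ∈ List (G × G) ]
                (∀ z₁ z₂ → S z₁ → S z₂ → u ≡ z₁ · z₂ → (z₁ , z₂) ∈ L)

module Theory (M : IntegralMonoid) where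
  open IntegralMonoid M

  pow : G → ℕ → G
  pow p zero    = e
  pow p (suc k) = p · pow p k

  _∣_ : G → G → Set
  u ∣ w = Σ[ c ∈ G ] (S c × w ≡ u · c)

  _‡_ : G → G → Set
  v ‡ w = Σ[ c ∈ G ] (S c × w ≡ c · v)

  IsLcm : G → G → G → Set
  IsLcm u v w = S w × (∀ x → ((u ∣ x) × (v ∣ x)) ⇔ (w ∣ x))

  -- gcd(u,v) = g  iff  g is the lcm of the set of common divisors
  -- of u and v, i.e.  ⋂_{d common divisor} dS = gS
  IsGcd : G → G → G → Set
  IsGcd u v g = S g × (∀ x → (∀ d → S d → d ∣ u → d ∣ v → d ∣ x) ⇔ (g ∣ x))

  TauIs : G → ℕ → Set
  TauIs z n = Σ[ L ∈ List (G × G) ] (Unique L × length L ≡ n ×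
                (∀ z₁ z₂ → (S z₁ × S z₂ × z ≡ z₁ · z₂) ⇔ ((z₁ , z₂) ∈ L)))

  Prime : G → Set
  Prime p = S p × TauIs p 2

  C₁ : G × G → Set
  C₁ (a , b) = Σ[ u ∈ G ] Σ[ v ∈ G ] Σ[ l ∈ G ]
                 (S u × S v × IsGcd u v e × IsLcm u v l × a ≡ u × b ≡ inv u · l)

  data Γ : G × G → G × G → Set where
    γ₁    : ∀ {u v l} → S u → S v → IsGcd u v e → IsLcm u v l →
            Γ (u , inv u · l) (v , inv v · l)
    γprime : ∀ {p} → Prime p → Γ (p , p) (p , p)
    γleft : ∀ {u₁ u₂ v ṽ ṽ' ũ₁ ũ₂} → u₁ ≢ e → u₂ ≢ e →
            Γ (u₂ , v) (ṽ , ũ₂) → Γ (u₁ , ṽ) (ṽ' , ũ₁) →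
            Γ (u₁ · u₂ , v) (ṽ' , ũ₁ · ũ₂)
    γright : ∀ {u v₁ v₂ ṽ₁ ṽ₂ ũ ũ'} → v₁ ≢ e → v₂ ≢ e →
            Γ (u , v₁) (ṽ₁ , ũ) → Γ (ũ , v₂) (ṽ₂ , ũ') →
            Γ (u , v₁ · v₂) (ṽ₁ · ṽ₂ , ũ')

  C : G × G → Set
  C x = C₁ x ⊎ (Σ[ y ∈ G × G ] Γ x y) ⊎ (Σ[ y ∈ G × G ] Γ y x)

  -- castlable: Γ is the graph of a map η : 𝔆 → 𝔆
  Castlable : Set
  Castlable = (∀ x → C x → Σ[ y ∈ G × G ] Γ x y)
            × (∀ x y y' → Γ x y → Γ x y' → y ≡ y')

  -- natural: castlable + Axiom V
  Natural : Set
  Natural = Castlable ×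
    (∀ p q k l → Prime p → Prime q → C (pow p k , pow q l) →
       Σ[ r ∈ G ] Σ[ t ∈ G ] (Prime r × Prime t ×
          Γ (pow p k , pow q l) (pow r l , pow t k)))

  FullyCastlable : G → Set
  FullyCastlable u = ∀ u₁ u₂ u₃ u₄ → S u₁ → S u₂ → S u₃ → S u₄ →
                     u ≡ u₁ · u₂ · u₃ · u₄ → C (u₂ , u₃)

  MaxPow∣ : G → G → ℕ → Set
  MaxPow∣ p u m = pow p m ∣ u × (∀ k → pow p k ∣ u → k ≤ m)

  MaxPow‡ : G → G → ℕ → Set
  MaxPow‡ p u m = pow p m ‡ u × (∀ k → pow p k ‡ u → k ≤ m)

  -- Ω(u) = n : the sum over all primes of max{m : p^m ∣ u} equals n.
  -- Primes outside the list L do not divide u, so contribute 0.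
  HasΩ : G → ℕ → Set
  HasΩ u n = Σ[ L ∈ List G ] (Unique L × All Prime L ×
               (∀ p → Prime p → p ∣ u → p ∈ L) ×
               Σ[ m ∈ (G → ℕ) ] (All (λ p → MaxPow∣ p u (m p)) L ×
                                  sum (map m L) ≡ n))

  HasΩ‡ : G → ℕ → Set
  HasΩ‡ u n = Σ[ L ∈ List G ] (Unique L × All Prime L ×
               (∀ p → Prime p → p ‡ u → p ∈ L) ×
               Σ[ m ∈ (G → ℕ) ] (All (λ p → MaxPow‡ p u (m p)) L ×
                                  sum (map m L) ≡ n))

{-# OPTIONS --safe #-}
-- For a prime p and 1 ≤ i ≤ max{m : pᵐ ∣ u} write u = pⁱ w and castle pⁱ past w one prime factor at a
-- time: full castlability keeps every intermediate pair in 𝔆, and Axiom V keeps the moving factor an i-th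
-- power of a prime, so η(pⁱ , w) = (a , tⁱ) with tⁱ ‡ u. Since Γ is symmetric and functional, η is
-- injective, and tⁱ determines t, so (p , i) ↦ (t , i) injects the pairs counted by Ω(u) into those counted
-- by Ω‡(u); the mirror argument gives the reverse inequality. Prime factors exist only classically (S need
-- not be decidable), so the argument runs in the double-negation monad, which equality on ℕ escapes.
module Submission where

open import Level using (0ℓ)
open import Algebra.Bundles using (Group)
open import Algebra.Structures using (IsGroup)
import Algebra.Properties.Group as GroupProperties
open import Data.Empty using (⊥; ⊥-elim)
open import Data.List using (List; []; _∷_; length; map; _++_; upTo)
open import Data.List.Properties using (length-map; length-++; length-upTo; length-removeAt′)
open import Data.List.Membership.Propositional using (_∈_)
open import Data.List.Membership.Propositional.Properties
  using (∈-map⁺; ∈-map⁻; ∈-++⁺ˡ; ∈-++⁺ʳ; ∈-++⁻; ∈-upTo⁺; ∈-upTo⁻)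
open import Data.List.Relation.Unary.Any using (here; there; _─_)
open import Data.List.Relation.Unary.All as All using (All; []; _∷_)
open import Data.List.Relation.Unary.AllPairs using ([]; _∷_)
open import Data.List.Relation.Unary.Unique.Propositional using (Unique)
import Data.List.Relation.Unary.Unique.Propositional.Properties as Unique
open import Data.Nat as ℕ using (ℕ; zero; suc; _+_; _≤_; _<_; z≤n; s≤s)
open import Data.Nat.ListAction using (sum)
open import Data.Nat.Properties
  using (≤-refl; ≤-reflexive; ≤-trans; ≤-antisym; m≤n⇒∃[o]m+o≡n; +-comm; module ≤-Reasoning)
open import Data.Product using (Σ-syntax; ∃-syntax; ∃₂; _×_; _,_; proj₁; proj₂)
open import Data.Sum using (_⊎_; inj₁; inj₂)
open import Effect.Monad using (RawMonad)
open import Function.Bundles using (_⇔_; mk⇔; Equivalence)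
open import Relation.Binary.Definitions using (DecidableEquality)
open import Relation.Binary.PropositionalEquality
open import Relation.Nullary using (¬_; yes; no)
open import Relation.Nullary.Decidable using (map′; decidable-stable)
open import Relation.Nullary.Negation using (¬¬-Monad; ¬¬-map)

open import Defs

open RawMonad (¬¬-Monad {0ℓ}) using (_>>=_; pure)

¬¬-all : {A : Set} {P : A → Set} (xs : List A) → (∀ {x} → x ∈ xs → ¬ ¬ P x) → ¬ ¬ (∀ {x} → x ∈ xs → P x)
¬¬-all xs f = ¬¬-map (λ ps {x} → All.lookup ps {x})
  (All.sequenceA 0ℓ (RawMonad.rawApplicative ¬¬-Monad) (All.tabulate f))

∈-─ : {A : Set} {x y : A} {xs : List A} (x∈xs : x ∈ xs) → y ∈ xs → y ≢ x → y ∈ (xs ─ x∈xs)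
∈-─ (here refl)  (here refl)  y≢x = ⊥-elim (y≢x refl)
∈-─ (here _)     (there y∈xs) _   = y∈xs
∈-─ (there _)    (here refl)  _   = here refl
∈-─ (there x∈xs) (there y∈xs) y≢x = there (∈-─ x∈xs y∈xs y≢x)

∈-pair-cases : {A : Set} {x₁ x₂ y v w : A} →
  y ∈ x₁ ∷ x₂ ∷ [] → v ∈ x₁ ∷ x₂ ∷ [] → w ∈ x₁ ∷ x₂ ∷ [] → v ≢ w → y ≡ v ⊎ y ≡ w
∈-pair-cases (here refl)         (here refl)         _                   _   = inj₁ refl
∈-pair-cases (there (here refl)) (there (here refl)) _                   _   = inj₁ refl
∈-pair-cases (here refl)         _                   (here refl)         _   = inj₂ refl
∈-pair-cases (there (here refl)) _                   (there (here refl)) _   = inj₂ refl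
∈-pair-cases (here refl)         (there (here refl)) (there (here refl)) v≢w = ⊥-elim (v≢w refl)
∈-pair-cases (there (here refl)) (here refl)         (here refl)         v≢w = ⊥-elim (v≢w refl)

length-map-─ : {A B : Set} (g : A → B) {x : A} {xs : List A} (x∈xs : x ∈ xs) → length (map g (xs ─ x∈xs)) < length xs
length-map-─ g {xs = xs} x∈xs =
  subst (_< length xs) (sym (length-map g (xs ─ x∈xs))) (≤-reflexive (sym (length-removeAt′ xs _)))

-- Counting along an injection

length-≤-of-injection : {A B : Set} (R : A → B → Set) {xs : List A} {ys : List B} → Unique xs →
  (∀ {x} → x ∈ xs → ∃[ y ] (y ∈ ys × R x y)) →
  (∀ {x x′ y} → x ∈ xs → x′ ∈ xs → R x y → R x′ y → x ≡ x′) →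
  length xs ≤ length ys
length-≤-of-injection R {[]} _ _ _ = z≤n
length-≤-of-injection R {x ∷ xs} {ys} (x∉xs ∷ unique) f inj with f (here refl)
... | y , y∈ys , Rxy = begin
  suc (length xs)          ≤⟨ s≤s (length-≤-of-injection R unique f′ (λ x∈ x′∈ → inj (there x∈) (there x′∈))) ⟩
  suc (length (ys ─ y∈ys)) ≡⟨ length-removeAt′ ys _ ⟨
  length ys                ∎
  where
    open ≤-Reasoning
    f′ : ∀ {x′} → x′ ∈ xs → ∃[ y′ ] (y′ ∈ (ys ─ y∈ys) × R x′ y′)
    f′ x′∈xs with f (there x′∈xs)
    ... | y′ , y′∈ys , Rx′y′ =
      y′ , ∈-─ y∈ys y′∈ys (λ { refl → All.lookup x∉xs x′∈xs (inj (here refl) (there x′∈xs) Rxy Rx′y′) }) ,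
      Rx′y′

module _ {A : Set} (m : A → ℕ) where

  pairsBelow : List A → List (A × ℕ)
  pairsBelow []       = []
  pairsBelow (p ∷ ps) = map (p ,_) (upTo (m p)) ++ pairsBelow ps

  length-pairsBelow : ∀ ps → length (pairsBelow ps) ≡ sum (map m ps)
  length-pairsBelow []       = refl
  length-pairsBelow (p ∷ ps) = begin
    length (map (p ,_) (upTo (m p)) ++ pairsBelow ps)         ≡⟨ length-++ (map (p ,_) (upTo (m p))) ⟩
    length (map (p ,_) (upTo (m p))) + length (pairsBelow ps)
      ≡⟨ cong₂ _+_ (length-map (p ,_) (upTo (m p))) (length-pairsBelow ps) ⟩
    length (upTo (m p)) + sum (map m ps)                      ≡⟨ cong (_+ sum (map m ps)) (length-upTo (m p)) ⟩
    m p + sum (map m ps)                                      ∎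
    where open ≡-Reasoning

  ∈-pairsBelow⁻ : ∀ ps {p i} → (p , i) ∈ pairsBelow ps → p ∈ ps × i < m p
  ∈-pairsBelow⁻ (q ∷ qs) x∈ with ∈-++⁻ (map (q ,_) (upTo (m q))) x∈
  ... | inj₂ x∈qs = let p∈qs , i<mp = ∈-pairsBelow⁻ qs x∈qs in there p∈qs , i<mp
  ... | inj₁ x∈q with ∈-map⁻ (q ,_) x∈q
  ...   | _ , i∈upTo , refl = here refl , ∈-upTo⁻ i∈upTo

  ∈-pairsBelow⁺ : ∀ ps {p i} → p ∈ ps → i < m p → (p , i) ∈ pairsBelow ps
  ∈-pairsBelow⁺ (q ∷ qs) (here refl) i<mp = ∈-++⁺ˡ (∈-map⁺ (q ,_) (∈-upTo⁺ i<mp))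
  ∈-pairsBelow⁺ (q ∷ qs) (there p∈qs) i<mp = ∈-++⁺ʳ (map (q ,_) (upTo (m q))) (∈-pairsBelow⁺ qs p∈qs i<mp)

  pairsBelow-unique : ∀ {ps} → Unique ps → Unique (pairsBelow ps)
  pairsBelow-unique {[]}     _              = []
  pairsBelow-unique {p ∷ ps} (p∉ps ∷ unique) =
    Unique.++⁺ (Unique.map⁺ (cong proj₂) (Unique.upTo⁺ (m p))) (pairsBelow-unique unique) disjoint
    where
      disjoint : ∀ {x} → x ∈ map (p ,_) (upTo (m p)) × x ∈ pairsBelow ps → ⊥
      disjoint (x∈p , x∈ps) with ∈-map⁻ (p ,_) x∈p
      ... | _ , _ , refl = All.lookup p∉ps (proj₁ (∈-pairsBelow⁻ ps x∈ps)) refl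

-- Σ m counts the pairs (p , i) with i < m p; such a pair is sent to some (t , i).
sum-≤-of-injection : {A B : Set} (R : A → B → ℕ → Set) {m : A → ℕ} {m′ : B → ℕ} {ps : List A} {ts : List B} →
  Unique ps →
  (∀ {p} i → p ∈ ps → i < m p → ¬ ¬ (∃[ t ] (t ∈ ts × i < m′ t × R p t i))) →
  (∀ {p p′ t} i → p ∈ ps → p′ ∈ ps → R p t i → R p′ t i → p ≡ p′) →
  ¬ ¬ (sum (map m ps) ≤ sum (map m′ ts))
sum-≤-of-injection {A} {B} R {m} {m′} {ps} {ts} unique image inj = do
  f ← ¬¬-all (pairsBelow m ps) image′
  pure (subst₂ _≤_ (length-pairsBelow m ps) (length-pairsBelow m′ ts)
    (length-≤-of-injection R′ (pairsBelow-unique m unique) f inj′))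
  where
    R′ : A × ℕ → B × ℕ → Set
    R′ (p , i) (t , j) = i ≡ j × R p t i
    image′ : ∀ {x} → x ∈ pairsBelow m ps → ¬ ¬ (∃[ y ] (y ∈ pairsBelow m′ ts × R′ x y))
    image′ {p , i} x∈ = do
      t , t∈ts , i<m′t , Rpti ← image i (proj₁ (∈-pairsBelow⁻ m ps x∈)) (proj₂ (∈-pairsBelow⁻ m ps x∈))
      pure ((t , i) , ∈-pairsBelow⁺ m′ ts t∈ts i<m′t , refl , Rpti)
    inj′ : ∀ {x x′ y} → x ∈ pairsBelow m ps → x′ ∈ pairsBelow m ps → R′ x y → R′ x′ y → x ≡ x′
    inj′ {p , i} {_ , _} {_ , _} x∈ x′∈ (refl , Rpti) (refl , Rp′ti) =
      cong (_, i) (inj i (proj₁ (∈-pairsBelow⁻ m ps x∈)) (proj₁ (∈-pairsBelow⁻ m ps x′∈)) Rpti Rp′ti)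

module IntegralMonoidProperties (M : IntegralMonoid) where
  open IntegralMonoid M
  open Theory M
  open IsGroup isGroup using (assoc; identityˡ; identityʳ; inverseˡ)

  group : Group 0ℓ 0ℓ
  group = record { isGroup = isGroup }

  open GroupProperties group
    using (\\-leftDividesˡ; \\-leftDividesʳ; //-rightDividesˡ; //-rightDividesʳ; ∙-cancelˡ; ∙-cancelʳ; inverseʳ-unique)
  open ≡-Reasoning

  private
    variable
      a b c d x y z p q t l : G
      k : ℕ

  _≟_ : DecidableEquality G
  x ≟ y = map′ (proj₂ countable) (cong (proj₁ countable)) (proj₁ countable x ℕ.≟ proj₁ countable y)

  x·y≡e⇒x≡e : S x → S y → x · y ≡ e → x ≡ e
  x·y≡e⇒x≡e {x} {y} sx sy xy≡e = axI x sx (subst S (inverseʳ-unique x y xy≡e) sy)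

  x·y≡e⇒y≡e : S x → S y → x · y ≡ e → y ≡ e
  x·y≡e⇒y≡e {x} {y} sx sy xy≡e = begin
    y     ≡⟨ identityˡ y ⟨
    e · y ≡⟨ cong (_· y) (x·y≡e⇒x≡e sx sy xy≡e) ⟨
    x · y ≡⟨ xy≡e ⟩
    e     ∎

  ∣-refl : ∀ x → x ∣ x
  ∣-refl x = e , S-e , sym (identityʳ x)

  e∣ : S x → e ∣ x
  e∣ {x} sx = x , sx , sym (identityˡ x)

  ∣⇒S : S x → x ∣ y → S y
  ∣⇒S sx (c , sc , y≡xc) = subst S (sym y≡xc) (S-· sx sc)

  ∣-trans : x ∣ y → y ∣ z → x ∣ z
  ∣-trans {x} (c , sc , y≡xc) (d , sd , z≡yd) = c · d , S-· sc sd , trans z≡yd (trans (cong (_· d) y≡xc) (assoc x c d))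

  ∣-antisym : x ∣ y → y ∣ x → x ≡ y
  ∣-antisym {x} {y} (c , sc , y≡xc) (d , sd , x≡yd) = begin
    x      ≡⟨ identityʳ x ⟨
    x · e  ≡⟨ cong (x ·_) (x·y≡e⇒x≡e sc sd (∙-cancelˡ x (c · d) e x·cd≡x·e)) ⟨
    x · c  ≡⟨ y≡xc ⟨
    y      ∎
    where
      x·cd≡x·e : x · (c · d) ≡ x · e
      x·cd≡x·e = begin
        x · (c · d)  ≡⟨ assoc x c d ⟨
        (x · c) · d  ≡⟨ cong (_· d) y≡xc ⟨
        y · d        ≡⟨ x≡yd ⟨
        x            ≡⟨ identityʳ x ⟨
        x · e        ∎

  ∣-cancelˡ : (a · x) ∣ (a · y) → x ∣ y
  ∣-cancelˡ {a} {x} {y} (c , sc , ay≡axc) = c , sc , ∙-cancelˡ a y (x · c) (trans ay≡axc (assoc a x c))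

  inv·-quotient : ((c , _ , _) : x ∣ y) → inv x · y ≡ c
  inv·-quotient {x} (c , _ , y≡xc) = trans (cong (inv x ·_) y≡xc) (\\-leftDividesʳ x c)

  ·≡·⇒inv·≡·inv : a · c ≡ b · d → inv a · b ≡ c · inv d
  ·≡·⇒inv·≡·inv {a} {c} {b} {d} ac≡bd = begin
    inv a · b                   ≡⟨ cong (inv a ·_) (//-rightDividesʳ d b) ⟨
    inv a · ((b · d) · inv d)   ≡⟨ cong (λ v → inv a · (v · inv d)) ac≡bd ⟨
    inv a · ((a · c) · inv d)   ≡⟨ cong (inv a ·_) (assoc a c (inv d)) ⟩
    inv a · (a · (c · inv d))   ≡⟨ \\-leftDividesʳ a (c · inv d) ⟩
    c · inv d                   ∎

  inv·≡·inv⇒·≡· : inv a · b ≡ c · inv d → a · c ≡ b · d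
  inv·≡·inv⇒·≡· {a} {b} {c} {d} eq = begin
    a · c                   ≡⟨ cong (a ·_) (//-rightDividesˡ d c) ⟨
    a · ((c · inv d) · d)   ≡⟨ cong (λ v → a · (v · d)) eq ⟨
    a · ((inv a · b) · d)   ≡⟨ assoc a (inv a · b) d ⟨
    (a · (inv a · b)) · d   ≡⟨ cong (_· d) (\\-leftDividesˡ a b) ⟩
    b · d                   ∎

  ·-cong-middle : a · b ≡ c · d → x · a · b · y ≡ x · c · d · y
  ·-cong-middle {a} {b} {c} {d} {x} {y} ab≡cd = cong (_· y) (begin
    x · a · b    ≡⟨ assoc x a b ⟩
    x · (a · b)  ≡⟨ cong (x ·_) ab≡cd ⟩
    x · (c · d)  ≡⟨ assoc x c d ⟨
    x · c · d    ∎)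

  pad-with-e : a · b ≡ e · a · b · e
  pad-with-e {a} {b} = sym (trans (identityʳ (e · a · b)) (cong (_· b) (identityˡ a)))

  lcm-exists : S a → S b → ∃[ l ] IsLcm a b l
  lcm-exists {a} {b} sa sb with axII (inv a · b)
  ... | x , y , sx , sy , quotient , universal = a · x , S-· sa sx , λ X → mk⇔ (common⇒ X) (⇒common X)
    where
      common⇒ : ∀ X → a ∣ X × b ∣ X → (a · x) ∣ X
      common⇒ X ((c₁ , s₁ , X≡ac₁) , (c₂ , s₂ , X≡bc₂))
        with universal c₁ c₂ s₁ s₂ (·≡·⇒inv·≡·inv (trans (sym X≡ac₁) X≡bc₂))
      ... | c , sc , c₁≡xc , _ = c , sc , trans X≡ac₁ (trans (cong (a ·_) c₁≡xc) (sym (assoc a x c)))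
      ⇒common : ∀ X → (a · x) ∣ X → a ∣ X × b ∣ X
      ⇒common X (c , sc , X≡axc) =
        (x · c , S-· sx sc , trans X≡axc (assoc a x c)) ,
        (y · c , S-· sy sc , trans X≡axc (trans (cong (_· c) (inv·≡·inv⇒·≡· quotient)) (assoc b y c)))

  lcm-divisors : IsLcm a b l → a ∣ l × b ∣ l
  lcm-divisors {l = l} (_ , lcm) = Equivalence.from (lcm l) (∣-refl l)

  lcm-sym : IsLcm a b l → IsLcm b a l
  lcm-sym (sl , lcm) = sl , λ X → mk⇔ (λ (b∣ , a∣) → Equivalence.to (lcm X) (a∣ , b∣))
                                      (λ l∣ → let a∣ , b∣ = Equivalence.from (lcm X) l∣ in b∣ , a∣)

  gcd-sym : IsGcd a b d → IsGcd b a d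
  gcd-sym (sd , gcd) = sd , λ X → mk⇔ (λ common → Equivalence.to (gcd X) (λ d sd d∣a d∣b → common d sd d∣b d∣a))
                                      (λ d∣ c sc c∣b c∣a → Equivalence.from (gcd X) d∣ c sc c∣a c∣b)

  coprime-common-divisor : IsGcd a b e → S d → d ∣ a → d ∣ b → d ≡ e
  coprime-common-divisor (_ , gcd) sd d∣a d∣b with Equivalence.from (gcd e) (e∣ S-e) _ sd d∣a d∣b
  ... | c , sc , e≡dc = x·y≡e⇒x≡e sd sc (sym e≡dc)

  -- The relation Γ

  Γ⇒S : Γ (a , b) (c , d) → S a × S b × S c × S d
  Γ⇒S (γ₁ su sv _ lcm) =
    su , subst S (sym (inv·-quotient u∣l)) (proj₁ (proj₂ u∣l)) ,
    sv , subst S (sym (inv·-quotient v∣l)) (proj₁ (proj₂ v∣l))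
    where
      u∣l = proj₁ (lcm-divisors lcm)
      v∣l = proj₂ (lcm-divisors lcm)
  Γ⇒S (γprime (sp , _)) = sp , sp , sp , sp
  Γ⇒S (γleft _ _ Γ₂ Γ₁) with Γ⇒S Γ₂ | Γ⇒S Γ₁
  ... | su₂ , sv , _ , sũ₂ | su₁ , _ , sṽ′ , sũ₁ = S-· su₁ su₂ , sv , sṽ′ , S-· sũ₁ sũ₂
  Γ⇒S (γright _ _ Γ₁ Γ₂) with Γ⇒S Γ₁ | Γ⇒S Γ₂
  ... | su , sv₁ , sṽ₁ , _ | _ , sv₂ , sṽ₂ , sũ′ = su , S-· sv₁ sv₂ , S-· sṽ₁ sṽ₂ , sũ′

  Γ-product : Γ (a , b) (c , d) → a · b ≡ c · d
  Γ-product (γ₁ {u} {v} {l} _ _ _ _) = trans (\\-leftDividesˡ u l) (sym (\\-leftDividesˡ v l))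
  Γ-product (γprime _) = refl
  Γ-product (γleft {u₁} {u₂} {v} {ṽ} {ṽ′} {ũ₁} {ũ₂} _ _ Γ₂ Γ₁) = begin
    (u₁ · u₂) · v   ≡⟨ assoc u₁ u₂ v ⟩
    u₁ · (u₂ · v)   ≡⟨ cong (u₁ ·_) (Γ-product Γ₂) ⟩
    u₁ · (ṽ · ũ₂)   ≡⟨ assoc u₁ ṽ ũ₂ ⟨
    (u₁ · ṽ) · ũ₂   ≡⟨ cong (_· ũ₂) (Γ-product Γ₁) ⟩
    (ṽ′ · ũ₁) · ũ₂  ≡⟨ assoc ṽ′ ũ₁ ũ₂ ⟩
    ṽ′ · (ũ₁ · ũ₂)  ∎
  Γ-product (γright {u} {v₁} {v₂} {ṽ₁} {ṽ₂} {ũ} {ũ′} _ _ Γ₁ Γ₂) = begin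
    u · (v₁ · v₂)   ≡⟨ assoc u v₁ v₂ ⟨
    (u · v₁) · v₂   ≡⟨ cong (_· v₂) (Γ-product Γ₁) ⟩
    (ṽ₁ · ũ) · v₂   ≡⟨ assoc ṽ₁ ũ v₂ ⟩
    ṽ₁ · (ũ · v₂)   ≡⟨ cong (ṽ₁ ·_) (Γ-product Γ₂) ⟩
    ṽ₁ · (ṽ₂ · ũ′)  ≡⟨ assoc ṽ₁ ṽ₂ ũ′ ⟨
    (ṽ₁ · ṽ₂) · ũ′  ∎

  Γ-outer-trivial : Γ (a , b) (c , d) → d ≡ e → a ≡ e
  Γ-outer-trivial (γ₁ {u} {v} {l} su _ coprime lcm) d≡e =
    coprime-common-divisor coprime su (∣-refl u) (subst (u ∣_) l≡v (proj₁ (lcm-divisors lcm)))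
    where
      l≡v : l ≡ v
      l≡v = trans (sym (\\-leftDividesˡ v l)) (trans (cong (v ·_) d≡e) (identityʳ v))
  Γ-outer-trivial (γprime _) d≡e = d≡e
  Γ-outer-trivial (γleft u₁≢e _ Γ₂ Γ₁) ũ₁ũ₂≡e with Γ⇒S Γ₂ | Γ⇒S Γ₁
  ... | _ , _ , _ , sũ₂ | _ , _ , _ , sũ₁ =
    ⊥-elim (u₁≢e (Γ-outer-trivial Γ₁ (x·y≡e⇒x≡e sũ₁ sũ₂ ũ₁ũ₂≡e)))
  Γ-outer-trivial (γright _ _ Γ₁ Γ₂) ũ′≡e = Γ-outer-trivial Γ₁ (Γ-outer-trivial Γ₂ ũ′≡e)

  Γ-inner-trivial : Γ (a , b) (c , d) → c ≡ e → b ≡ e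
  Γ-inner-trivial (γ₁ {u} {l = l} su _ _ lcm) v≡e = trans (cong (inv u ·_) l≡u) (inverseˡ u)
    where
      l≡u : l ≡ u
      l≡u = ∣-antisym (Equivalence.to (proj₂ lcm u) (∣-refl u , subst (_∣ u) (sym v≡e) (e∣ su)))
                      (proj₁ (lcm-divisors lcm))
  Γ-inner-trivial (γprime _) c≡e = c≡e
  Γ-inner-trivial (γleft _ _ Γ₂ Γ₁) ṽ′≡e = Γ-inner-trivial Γ₂ (Γ-inner-trivial Γ₁ ṽ′≡e)
  Γ-inner-trivial (γright v₁≢e _ Γ₁ Γ₂) ṽ₁ṽ₂≡e with Γ⇒S Γ₁ | Γ⇒S Γ₂
  ... | _ , _ , sṽ₁ , _ | _ , _ , sṽ₂ , _ =
    ⊥-elim (v₁≢e (Γ-inner-trivial Γ₁ (x·y≡e⇒x≡e sṽ₁ sṽ₂ ṽ₁ṽ₂≡e)))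

  Γ-sym : Γ (a , b) (c , d) → Γ (c , d) (a , b)
  Γ-sym (γ₁ su sv coprime lcm) = γ₁ sv su (gcd-sym coprime) (lcm-sym lcm)
  Γ-sym (γprime pp) = γprime pp
  Γ-sym (γleft u₁≢e u₂≢e Γ₂ Γ₁) =
    γright (λ ũ₁≡e → u₁≢e (Γ-outer-trivial Γ₁ ũ₁≡e)) (λ ũ₂≡e → u₂≢e (Γ-outer-trivial Γ₂ ũ₂≡e))
           (Γ-sym Γ₁) (Γ-sym Γ₂)
  Γ-sym (γright v₁≢e v₂≢e Γ₁ Γ₂) =
    γleft (λ ṽ₁≡e → v₁≢e (Γ-inner-trivial Γ₁ ṽ₁≡e)) (λ ṽ₂≡e → v₂≢e (Γ-inner-trivial Γ₂ ṽ₂≡e))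
          (Γ-sym Γ₂) (Γ-sym Γ₁)

  Γ-unitʳ : S x → Γ (x , e) (e , x)
  Γ-unitʳ {x} sx = subst₂ (λ b d → Γ (x , b) (e , d)) (inverseˡ x) inv-e·x≡x (γ₁ sx S-e coprime lcm)
    where
      inv-e·x≡x : inv e · x ≡ x
      inv-e·x≡x = trans (cong (_· x) (sym (inverseʳ-unique e e (identityˡ e)))) (identityˡ x)
      coprime : IsGcd x e e
      coprime = S-e , λ X → mk⇔ (λ common → common e S-e (e∣ sx) (e∣ S-e))
        (λ e∣X d sd _ (c , sc , e≡dc) → subst (_∣ X) (sym (x·y≡e⇒x≡e sd sc (sym e≡dc))) e∣X)
      lcm : IsLcm x e x
      lcm = sx , λ X → mk⇔ proj₁ (λ x∣X → x∣X , e∣ (∣⇒S sx x∣X))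

  Γ-unitˡ : S x → Γ (e , x) (x , e)
  Γ-unitˡ sx = Γ-sym (Γ-unitʳ sx)

  -- Primes and their powers

  prime-factorizations : Prime p → Σ[ f₁ ∈ G × G ] Σ[ f₂ ∈ G × G ] (f₁ ≢ f₂ ×
    (∀ z₁ z₂ → (S z₁ × S z₂ × p ≡ z₁ · z₂) ⇔ ((z₁ , z₂) ∈ f₁ ∷ f₂ ∷ [])))
  prime-factorizations (_ , f₁ ∷ f₂ ∷ [] , ((f₁≢f₂ ∷ []) ∷ [] ∷ []) , _ , factorizations) =
    f₁ , f₂ , f₁≢f₂ , factorizations
  prime-factorizations (_ , []              , _ , () , _)
  prime-factorizations (_ , _ ∷ []          , _ , () , _)
  prime-factorizations (_ , _ ∷ _ ∷ _ ∷ _   , _ , () , _)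

  prime≢e : Prime p → p ≢ e
  prime≢e {p} pp p≡e with prime-factorizations pp
  ... | f₁ , f₂ , f₁≢f₂ , factorizations = f₁≢f₂ (trans (trivial (here refl)) (sym (trivial (there (here refl)))))
    where
      trivial : ∀ {f} → f ∈ f₁ ∷ f₂ ∷ [] → f ≡ (e , e)
      trivial {z₁ , z₂} f∈ with Equivalence.from (factorizations z₁ z₂) f∈
      ... | s₁ , s₂ , p≡z₁z₂ = let z₁z₂≡e = trans (sym p≡z₁z₂) p≡e in
        cong₂ _,_ (x·y≡e⇒x≡e s₁ s₂ z₁z₂≡e) (x·y≡e⇒y≡e s₁ s₂ z₁z₂≡e)

  prime-irreducible : Prime p → S a → S b → p ≡ a · b → a ≡ e ⊎ b ≡ e
  prime-irreducible {p} pp@(sp , _) sa sb p≡ab with prime-factorizations pp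
  ... | _ , _ , _ , factorizations
    with ∈-pair-cases (factor sa sb p≡ab) (factor S-e sp (sym (identityˡ p))) (factor sp S-e (sym (identityʳ p)))
           (λ ep≡pe → prime≢e pp (sym (cong proj₁ ep≡pe)))
    where
      factor : ∀ {z₁ z₂} → S z₁ → S z₂ → p ≡ z₁ · z₂ → (z₁ , z₂) ∈ _
      factor s₁ s₂ p≡ = Equivalence.to (factorizations _ _) (s₁ , s₂ , p≡)
  ... | inj₁ ab≡ep = inj₁ (cong proj₁ ab≡ep)
  ... | inj₂ ab≡pe = inj₂ (cong proj₂ ab≡pe)

  irreducible⇒prime : S x → x ≢ e → (∀ a b → S a → S b → x ≡ a · b → a ≡ e ⊎ b ≡ e) → Prime x
  irreducible⇒prime {x} sx x≢e irreducible =
    sx , (e , x) ∷ (x , e) ∷ [] , ((ex≢xe ∷ []) ∷ [] ∷ []) , refl , λ z₁ z₂ → mk⇔ factorization⇒ ⇒factorization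
    where
      ex≢xe : (e , x) ≢ (x , e)
      ex≢xe ex≡xe = x≢e (sym (cong proj₁ ex≡xe))
      factorization⇒ : ∀ {z₁ z₂} → S z₁ × S z₂ × x ≡ z₁ · z₂ → (z₁ , z₂) ∈ (e , x) ∷ (x , e) ∷ []
      factorization⇒ {z₁} {z₂} (s₁ , s₂ , x≡z₁z₂) with irreducible z₁ z₂ s₁ s₂ x≡z₁z₂
      ... | inj₁ refl = here (cong (e ,_) (trans (sym (identityˡ z₂)) (sym x≡z₁z₂)))
      ... | inj₂ refl = there (here (cong (_, e) (trans (sym (identityʳ z₁)) (sym x≡z₁z₂))))
      ⇒factorization : ∀ {z₁ z₂} → (z₁ , z₂) ∈ (e , x) ∷ (x , e) ∷ [] → S z₁ × S z₂ × x ≡ z₁ · z₂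
      ⇒factorization (here refl)         = S-e , sx , sym (identityˡ x)
      ⇒factorization (there (here refl)) = sx , S-e , sym (identityʳ x)

  prime-divisor : Prime p → S d → d ∣ p → d ≡ e ⊎ d ≡ p
  prime-divisor {p} {d} pp sd (c , sc , p≡dc) with prime-irreducible pp sd sc p≡dc
  ... | inj₁ d≡e = inj₁ d≡e
  ... | inj₂ c≡e = inj₂ (sym (trans p≡dc (trans (cong (d ·_) c≡e) (identityʳ d))))

  distinct-primes-coprime : Prime p → Prime q → p ≢ q → IsGcd p q e
  distinct-primes-coprime {p} {q} pp pq p≢q = S-e , λ X → mk⇔ (λ common → common e S-e (e∣ (proj₁ pp)) (e∣ (proj₁ pq)))
      (λ e∣X d sd d∣p d∣q → subst (_∣ X) (sym (common-divisor-trivial sd d∣p d∣q)) e∣X)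
    where
      common-divisor-trivial : S d → d ∣ p → d ∣ q → d ≡ e
      common-divisor-trivial sd d∣p d∣q with prime-divisor pp sd d∣p
      ... | inj₁ d≡e = d≡e
      ... | inj₂ refl with prime-divisor pq sd d∣q
      ...   | inj₁ p≡e = ⊥-elim (prime≢e pp p≡e)
      ...   | inj₂ p≡q = ⊥-elim (p≢q p≡q)

  S-pow : ∀ k → S p → S (pow p k)
  S-pow zero    _  = S-e
  S-pow (suc k) sp = S-· sp (S-pow k sp)

  pow-+ : ∀ p i j → pow p (i + j) ≡ pow p i · pow p j
  pow-+ p zero    j = sym (identityˡ (pow p j))
  pow-+ p (suc i) j = trans (cong (p ·_) (pow-+ p i j)) (sym (assoc p (pow p i) (pow p j)))

  pow-suc′ : ∀ p k → pow p (suc k) ≡ pow p k · p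
  pow-suc′ p k = begin
    pow p (suc k)        ≡⟨ cong (pow p) (+-comm 1 k) ⟩
    pow p (k + 1)        ≡⟨ pow-+ p k 1 ⟩
    pow p k · (p · e)    ≡⟨ cong (pow p k ·_) (identityʳ p) ⟩
    pow p k · p          ∎

  pow≡prime⇒≡ : ∀ i → Prime p → Prime q → q ≡ pow p i → q ≡ p
  pow≡prime⇒≡ zero          _  pq q≡e = ⊥-elim (prime≢e pq q≡e)
  pow≡prime⇒≡ (suc zero)    _  _  q≡p = trans q≡p (identityʳ _)
  pow≡prime⇒≡ (suc (suc i)) pp pq q≡p·pⁱ⁺¹
    with prime-irreducible pq (proj₁ pp) (S-pow (suc i) (proj₁ pp)) q≡p·pⁱ⁺¹
  ... | inj₁ p≡e   = ⊥-elim (prime≢e pp p≡e)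
  ... | inj₂ pⁱ⁺¹≡e  = ⊥-elim (prime≢e pp (x·y≡e⇒x≡e (proj₁ pp) (S-pow i (proj₁ pp)) pⁱ⁺¹≡e))

  pow-∣-mono : ∀ {i j} → S p → i ≤ j → pow p j ∣ x → pow p i ∣ x
  pow-∣-mono {p} {i = i} sp i≤j (c , sc , x≡pʲc) with m≤n⇒∃[o]m+o≡n i≤j
  ... | o , refl = pow p o · c , S-· (S-pow o sp) sc ,
    trans x≡pʲc (trans (cong (_· c) (pow-+ p i o)) (assoc (pow p i) (pow p o) c))

  pow-‡-mono : ∀ {i j} → S p → i ≤ j → pow p j ‡ x → pow p i ‡ x
  pow-‡-mono {p} {i = i} sp i≤j (c , sc , x≡cpʲ) with m≤n⇒∃[o]m+o≡n i≤j
  ... | o , refl = c · pow p o , S-· sc (S-pow o sp) ,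
    trans x≡cpʲ (trans (cong (c ·_) (trans (cong (pow p) (+-comm i o)) (pow-+ p o i)))
                       (sym (assoc c (pow p o) (pow p i))))

  pow-suc-∣⇒∣ : ∀ i → S p → pow p (suc i) ∣ x → p ∣ x
  pow-suc-∣⇒∣ {p} i sp (c , sc , x≡) = pow p i · c , S-· (S-pow i sp) sc , trans x≡ (assoc p (pow p i) c)

  pow-suc-‡⇒‡ : ∀ i → S p → pow p (suc i) ‡ x → p ‡ x
  pow-suc-‡⇒‡ {p} i sp (c , sc , x≡) =
    c · pow p i , S-· sc (S-pow i sp) , trans x≡ (trans (cong (c ·_) (pow-suc′ p i)) (sym (assoc c (pow p i) p)))

  -- Induction along factorizations

  Covers : G → List (G × G) → Set
  Covers x fs = ∀ z₁ z₂ → S z₁ → S z₂ → x ≡ z₁ · z₂ → (z₁ , z₂) ∈ fs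

  -- Factorizations of a proper factor lift injectively to those of x, missing (x , e) resp. (e , x).
  covers-left-factor : ∀ {fs} → Covers x fs → S a → S b → b ≢ e → x ≡ a · b →
                       ∃[ fs′ ] (Covers a fs′ × length fs′ < length fs)
  covers-left-factor {x} {a} {b} {fs} covers sa sb b≢e x≡ab =
    map unlift (fs ─ xe∈fs) , covers′ , length-map-─ unlift xe∈fs
    where
      xe∈fs = covers x e (∣⇒S sa (b , sb , x≡ab)) S-e (sym (identityʳ x))
      unlift : G × G → G × G
      unlift (z₁ , z₂) = z₁ , z₂ · inv b
      covers′ : Covers a (map unlift (fs ─ xe∈fs))
      covers′ z₁ z₂ s₁ s₂ a≡z₁z₂ =
        subst (_∈ _) (cong (z₁ ,_) (//-rightDividesʳ b z₂))
          (∈-map⁺ unlift (∈-─ xe∈fs (covers z₁ (z₂ · b) s₁ (S-· s₂ sb) x≡z₁z₂b)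
            (λ lift≡xe → b≢e (x·y≡e⇒y≡e s₂ sb (cong proj₂ lift≡xe)))))
        where
          x≡z₁z₂b : x ≡ z₁ · (z₂ · b)
          x≡z₁z₂b = trans x≡ab (trans (cong (_· b) a≡z₁z₂) (assoc z₁ z₂ b))

  covers-right-factor : ∀ {fs} → Covers x fs → S a → S b → a ≢ e → x ≡ a · b →
                        ∃[ fs′ ] (Covers b fs′ × length fs′ < length fs)
  covers-right-factor {x} {a} {b} {fs} covers sa sb a≢e x≡ab =
    map unlift (fs ─ ex∈fs) , covers′ , length-map-─ unlift ex∈fs
    where
      ex∈fs = covers e x S-e (∣⇒S sa (b , sb , x≡ab)) (sym (identityˡ x))
      unlift : G × G → G × G
      unlift (z₁ , z₂) = inv a · z₁ , z₂
      covers′ : Covers b (map unlift (fs ─ ex∈fs))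
      covers′ z₁ z₂ s₁ s₂ b≡z₁z₂ =
        subst (_∈ _) (cong (_, z₂) (\\-leftDividesʳ a z₁))
          (∈-map⁺ unlift (∈-─ ex∈fs (covers (a · z₁) z₂ (S-· sa s₁) s₂ x≡az₁z₂)
            (λ lift≡ex → a≢e (x·y≡e⇒x≡e sa s₁ (cong proj₁ lift≡ex)))))
        where
          x≡az₁z₂ : x ≡ (a · z₁) · z₂
          x≡az₁z₂ = trans x≡ab (trans (cong (a ·_) b≡z₁z₂) (sym (assoc a z₁ z₂)))

  -- Axiom (III) makes "is a proper left or right factor of" well founded on S.
  factor-induction : (P : G → Set) →
    (∀ x → S x → (∀ a b → S a → S b → x ≡ a · b → (b ≢ e → P a) × (a ≢ e → P b)) → P x) →
    ∀ x → S x → P x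
  factor-induction P step x sx = go (suc (length (proj₁ (axIII x sx)))) sx (proj₂ (axIII x sx)) ≤-refl
    where
      go : ∀ n {x fs} → S x → Covers x fs → length fs < n → P x
      go (suc n) {x} sx covers (s≤s fs≤n) = step x sx λ a b sa sb x≡ab →
        (λ b≢e → let fs′ , covers′ , shorter = covers-left-factor covers sa sb b≢e x≡ab
                 in go n sa covers′ (≤-trans shorter fs≤n)) ,
        (λ a≢e → let fs′ , covers′ , shorter = covers-right-factor covers sa sb a≢e x≡ab
                 in go n sb covers′ (≤-trans shorter fs≤n))

  HasPrimeFactor : G → Set
  HasPrimeFactor x = ∃₂ λ q x₂ → Prime q × S x₂ × x ≡ q · x₂

  -- Either x is irreducible, hence prime, or a prime factor of a proper left factor divides x.
  prime-factor-exists : S x → x ≢ e → ¬ ¬ HasPrimeFactor x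
  prime-factor-exists {x} = factor-induction (λ x → x ≢ e → ¬ ¬ HasPrimeFactor x) step x
    where
      step : ∀ x → S x →
             (∀ a b → S a → S b → x ≡ a · b →
               (b ≢ e → a ≢ e → ¬ ¬ HasPrimeFactor a) × (a ≢ e → b ≢ e → ¬ ¬ HasPrimeFactor b)) →
             x ≢ e → ¬ ¬ HasPrimeFactor x
      step x sx ih x≢e no-factor = no-factor (x , e , irreducible⇒prime sx x≢e irreducible , S-e , sym (identityʳ x))
        where
          irreducible : ∀ a b → S a → S b → x ≡ a · b → a ≡ e ⊎ b ≡ e
          irreducible a b sa sb x≡ab with a ≟ e | b ≟ e
          ... | yes a≡e | _       = inj₁ a≡e
          ... | no _    | yes b≡e = inj₂ b≡e
          ... | no a≢e  | no b≢e  = ⊥-elim (proj₁ (ih a b sa sb x≡ab) b≢e a≢e λ (q , a₂ , pq , sa₂ , a≡qa₂) →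
            no-factor (q , a₂ · b , pq , S-· sa₂ sb , trans x≡ab (trans (cong (_· b) a≡qa₂) (assoc q a₂ b))))

  prime-induction : (P : G → Set) → P e → (∀ {q w} → Prime q → S w → P w → P (q · w)) → ∀ w → S w → ¬ ¬ P w
  prime-induction P base step = factor-induction (λ w → ¬ ¬ P w) induct
    where
      induct : ∀ w → S w →
               (∀ a b → S a → S b → w ≡ a · b → (b ≢ e → ¬ ¬ P a) × (a ≢ e → ¬ ¬ P b)) → ¬ ¬ P w
      induct w sw ih with w ≟ e
      ... | yes refl = pure base
      ... | no w≢e = do
        q , w₂ , pq , sw₂ , w≡qw₂ ← prime-factor-exists sw w≢e
        Pw₂ ← proj₂ (ih q w₂ (proj₁ pq) sw₂ w≡qw₂) (prime≢e pq)
        pure (subst P (sym w≡qw₂) (step pq sw₂ Pw₂))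

  module NaturalMonoidProperties (natural : Natural) where

    Γ-functional : ∀ {X Y Y′} → Γ X Y → Γ X Y′ → Y ≡ Y′
    Γ-functional = proj₂ (proj₁ natural) _ _ _

    Γ-injective : ∀ {a b c d a′ b′} → Γ (a , b) (c , d) → Γ (a′ , b′) (c , d) → (a , b) ≡ (a′ , b′)
    Γ-injective Γ₁ Γ₂ = Γ-functional (Γ-sym Γ₁) (Γ-sym Γ₂)

    Γ-composeˡ : ∀ {u₁ u₂ v ṽ ṽ′ ũ₁ ũ₂} →
                 Γ (u₂ , v) (ṽ , ũ₂) → Γ (u₁ , ṽ) (ṽ′ , ũ₁) → Γ (u₁ · u₂ , v) (ṽ′ , ũ₁ · ũ₂)
    Γ-composeˡ {u₁} {u₂} Γ₂ Γ₁ with u₁ ≟ e | u₂ ≟ e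
    ... | no u₁≢e | no u₂≢e = γleft u₁≢e u₂≢e Γ₂ Γ₁
    ... | yes refl | _ with Γ-functional Γ₁ (Γ-unitˡ (proj₁ (proj₂ (proj₂ (Γ⇒S Γ₂)))))
    ...   | refl = subst₂ (λ a d → Γ (a , _) (_ , d)) (sym (identityˡ u₂)) (sym (identityˡ _)) Γ₂
    Γ-composeˡ {u₁} Γ₂ Γ₁ | no _ | yes refl with Γ-functional Γ₂ (Γ-unitˡ (proj₁ (proj₂ (Γ⇒S Γ₂))))
    ...   | refl = subst₂ (λ a d → Γ (a , _) (_ , d)) (sym (identityʳ u₁)) (sym (identityʳ _)) Γ₁

    Γ-composeʳ : ∀ {u v₁ v₂ ṽ₁ ṽ₂ ũ ũ′} →
                 Γ (u , v₁) (ṽ₁ , ũ) → Γ (ũ , v₂) (ṽ₂ , ũ′) → Γ (u , v₁ · v₂) (ṽ₁ · ṽ₂ , ũ′)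
    Γ-composeʳ {v₁ = v₁} {v₂} Γ₁ Γ₂ with v₁ ≟ e | v₂ ≟ e
    ... | no v₁≢e | no v₂≢e = γright v₁≢e v₂≢e Γ₁ Γ₂
    ... | yes refl | _ with Γ-functional Γ₁ (Γ-unitʳ (proj₁ (Γ⇒S Γ₁)))
    ...   | refl = subst₂ (λ b c → Γ (_ , b) (c , _)) (sym (identityˡ v₂)) (sym (identityˡ _)) Γ₂
    Γ-composeʳ {v₁ = v₁} Γ₁ Γ₂ | no _ | yes refl with Γ-functional Γ₂ (Γ-unitʳ (proj₂ (proj₂ (proj₂ (Γ⇒S Γ₁)))))
    ...   | refl = subst₂ (λ b c → Γ (_ , b) (c , _)) (sym (identityʳ v₁)) (sym (identityʳ _)) Γ₁

    Γ-prime-pow : Prime p → ∀ i → Γ (p , pow p i) (pow p i , p)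
    Γ-prime-pow pp zero    = Γ-unitʳ (proj₁ pp)
    Γ-prime-pow pp (suc i) = Γ-composeʳ (γprime pp) (Γ-prime-pow pp i)

    castle-pow-prime : Prime p → Prime q → C (pow p k , q) → ∃₂ λ r t → Prime r × Prime t × Γ (pow p k , q) (r , pow t k)
    castle-pow-prime {p} {q} {k} pp pq C-pair
      with proj₂ natural p q k 1 pp pq (subst (λ v → C (pow p k , v)) (sym (identityʳ q)) C-pair)
    ... | r , t , pr , pt , Γ′ =
      r , t , pr , pt , subst₂ (λ v w → Γ (pow p k , v) (w , pow t k)) (identityʳ q) (identityʳ r) Γ′

    castle-prime-pow : Prime q → Prime t → C (q , pow t k) → ∃₂ λ r s → Prime r × Prime s × Γ (q , pow t k) (pow r k , s)
    castle-prime-pow {q} {t} {k} pq pt C-pair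
      with proj₂ natural q t 1 k pq pt (subst (λ v → C (v , pow t k)) (sym (identityʳ q)) C-pair)
    ... | r , s , pr , ps , Γ′ =
      r , s , pr , ps , subst₂ (λ v w → Γ (v , pow t k) (pow r k , w)) (identityʳ q) (identityʳ s) Γ′

    module _ (pp : Prime p) where

      -- If q ≠ p then Γ (p , p⁻¹ lcm[p , q]) (q , q⁻¹ lcm[p , q]), and p⁻¹ lcm[p , q] would be a power of p,
      -- against Γ (p , pⁱ) (pⁱ , p).
      prime-divisor-of-pow : ∀ j → (∀ {x} → S x → x ∣ pow p j → ¬ ¬ (∃[ i ] x ≡ pow p i)) →
                             Prime q → q ∣ pow p (suc j) → ¬ ¬ (q ≡ p)
      prime-divisor-of-pow {q} j divisors-are-powers pq q∣pʲ⁺¹ q≢p with lcm-exists (proj₁ pp) (proj₁ pq)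
      ... | l , lcm with proj₁ (lcm-divisors lcm)
      ...   | y , sy , l≡py = divisors-are-powers sy y∣pʲ λ (i , y≡pⁱ) →
              q≢p (pow≡prime⇒≡ i pp pq (cong proj₁ (Γ-functional (Γ-lcm {i} y≡pⁱ) (Γ-prime-pow pp i))))
        where
          y∣pʲ : y ∣ pow p j
          y∣pʲ = ∣-cancelˡ (subst (_∣ pow p (suc j)) l≡py
                   (Equivalence.to (proj₂ lcm (pow p (suc j))) ((pow p j , S-pow j (proj₁ pp) , refl) , q∣pʲ⁺¹)))
          Γ-lcm : ∀ {i} → y ≡ pow p i → Γ (p , pow p i) (q , inv q · l)
          Γ-lcm {i} y≡pⁱ = subst (λ v → Γ (p , v) (q , inv q · l)) (trans (inv·-quotient (y , sy , l≡py)) y≡pⁱ)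
                             (γ₁ (proj₁ pp) (proj₁ pq) (distinct-primes-coprime pp pq (λ p≡q → q≢p (sym p≡q))) lcm)

      divisors-of-pow : ∀ j → S x → x ∣ pow p j → ¬ ¬ (∃[ i ] x ≡ pow p i)
      divisors-of-pow zero    sx (c , sc , e≡xc) = pure (0 , x·y≡e⇒x≡e sx sc (sym e≡xc))
      divisors-of-pow {x} (suc j) sx x∣pʲ⁺¹ with x ≟ e
      ... | yes x≡e = pure (0 , x≡e)
      ... | no x≢e = do
        q , x₂ , pq , sx₂ , x≡qx₂ ← prime-factor-exists sx x≢e
        q≡p ← prime-divisor-of-pow j (divisors-of-pow j) pq (∣-trans (x₂ , sx₂ , x≡qx₂) x∣pʲ⁺¹)
        i , x₂≡pⁱ ← divisors-of-pow j sx₂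
          (∣-cancelˡ (subst (λ v → (v · x₂) ∣ pow p (suc j)) q≡p (subst (_∣ _) x≡qx₂ x∣pʲ⁺¹)))
        pure (suc i , trans x≡qx₂ (cong₂ _·_ q≡p x₂≡pⁱ))

    pow-injective : ∀ k → Prime t → Prime q → pow t (suc k) ≡ pow q (suc k) → t ≡ q
    pow-injective {t} {q} k pt pq tᵏ⁺¹≡qᵏ⁺¹ =
      decidable-stable (t ≟ q)
        (prime-divisor-of-pow pq k (divisors-of-pow pq k) pt (pow t k , S-pow k (proj₁ pt) , sym tᵏ⁺¹≡qᵏ⁺¹))

    module FullyCastlableProperties {u : G} (fully : FullyCastlable u) where

      PowerCastlesRight : G → Set
      PowerCastlesRight w = ∀ {y z p} k → S y → S z → Prime p → u ≡ y · pow p k · w · z →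
                            ∃₂ λ a t → Prime t × Γ (pow p k , w) (a , pow t k)

      -- Castle pᵏ past the prime factors of w one at a time, using Axiom V.
      power-castles-right : ∀ w → S w → ¬ ¬ PowerCastlesRight w
      power-castles-right = prime-induction PowerCastlesRight base step
        where
          base : PowerCastlesRight e
          base {p = p} k _ _ pp _ = e , p , pp , Γ-unitʳ (S-pow k (proj₁ pp))
          step : ∀ {q w} → Prime q → S w → PowerCastlesRight w → PowerCastlesRight (q · w)
          step {q} {w} pq sw ih {y} {z} {p} k sy sz pp u≡ypᵏqwz =
            let r , t , pr , pt , Γ₁ = castle-pow-prime {k = k} pp pq
                  (fully y (pow p k) q (w · z) sy (S-pow k (proj₁ pp)) (proj₁ pq) (S-· sw sz) u≡ypᵏq[wz])
                a , t′ , pt′ , Γ₂ = ih k (S-· sy (proj₁ pr)) sz pt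
                  (trans u≡ypᵏq[wz] (trans (·-cong-middle (Γ-product Γ₁)) (sym (assoc _ w z))))
            in r · a , t′ , pt′ , Γ-composeʳ Γ₁ Γ₂
            where
              u≡ypᵏq[wz] : u ≡ y · pow p k · q · (w · z)
              u≡ypᵏq[wz] = trans u≡ypᵏqwz (trans (cong (_· z) (sym (assoc _ q w))) (assoc _ w z))

      PowerCastlesLeft : G → Set
      PowerCastlesLeft a = ∀ {y z t} k → S y → S z → Prime t → u ≡ y · a · pow t k · z →
                           ∃₂ λ s b → Prime s × Γ (a , pow t k) (pow s k , b)

      power-castles-left : ∀ a → S a → ¬ ¬ PowerCastlesLeft a
      power-castles-left = prime-induction PowerCastlesLeft base step
        where
          base : PowerCastlesLeft e
          base {t = t} k _ _ pt _ = t , e , pt , Γ-unitˡ (S-pow k (proj₁ pt))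
          step : ∀ {q a} → Prime q → S a → PowerCastlesLeft a → PowerCastlesLeft (q · a)
          step {q} {a} pq sa ih {y} {z} {t} k sy sz pt u≡yqatᵏz =
            let s , b , ps , Γ₂ = ih k (S-· sy (proj₁ pq)) sz pt u≡yqatᵏz′
                r , s′ , pr , _ , Γ₁ = castle-prime-pow {k = k} pq ps
                  (fully y q (pow s k) (b · z) sy (proj₁ pq) (S-pow k (proj₁ ps)) (S-· (proj₂ (proj₂ (proj₂ (Γ⇒S Γ₂)))) sz)
                    (trans u≡yqatᵏz′ (trans (·-cong-middle (Γ-product Γ₂)) (assoc _ b z))))
            in r , s′ · b , pr , Γ-composeˡ Γ₂ Γ₁
            where
              u≡yqatᵏz′ : u ≡ y · q · a · pow t k · z
              u≡yqatᵏz′ = trans u≡yqatᵏz (cong (λ v → v · pow t k · z) (sym (assoc y q a)))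

      Ω≤Ω‡ : ∀ {n n′} → HasΩ u n → HasΩ‡ u n′ → ¬ ¬ (n ≤ n′)
      Ω≤Ω‡ (ps , unique , ps-prime , _ , m , m-max , refl) (ts , _ , _ , ts-complete , m′ , m′-max , refl) =
        sum-≤-of-injection CastlesTo unique image injective
        where
          CastlesTo : G → G → ℕ → Set
          CastlesTo p t i = ∃₂ λ w a → u ≡ pow p (suc i) · w × Γ (pow p (suc i) , w) (a , pow t (suc i))

          image : ∀ {p} i → p ∈ ps → i < m p → ¬ ¬ (∃[ t ] (t ∈ ts × i < m′ t × CastlesTo p t i))
          image i p∈ps i<mp with pow-∣-mono (proj₁ (All.lookup ps-prime p∈ps)) i<mp (proj₁ (All.lookup m-max p∈ps))
          ... | w , sw , u≡pⁱ⁺¹w = ¬¬-map castle (power-castles-right w sw)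
            where
              castle : PowerCastlesRight w → ∃[ t ] (t ∈ ts × i < m′ t × CastlesTo _ t i)
              castle castles with castles (suc i) S-e S-e (All.lookup ps-prime p∈ps) (trans u≡pⁱ⁺¹w pad-with-e)
              ... | a , t , pt , Γ′ =
                t , t∈ts , proj₂ (All.lookup m′-max t∈ts) (suc i) tⁱ⁺¹‡u , w , a , u≡pⁱ⁺¹w , Γ′
                where
                  tⁱ⁺¹‡u : pow t (suc i) ‡ u
                  tⁱ⁺¹‡u = a , proj₁ (proj₂ (proj₂ (Γ⇒S Γ′))) , trans u≡pⁱ⁺¹w (Γ-product Γ′)
                  t∈ts : t ∈ ts
                  t∈ts = ts-complete t pt (pow-suc-‡⇒‡ i (proj₁ pt) tⁱ⁺¹‡u)

          injective : ∀ {p p′ t} i → p ∈ ps → p′ ∈ ps → CastlesTo p t i → CastlesTo p′ t i → p ≡ p′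
          injective {t = t} i p∈ps p′∈ps (_ , a , u≡ , Γ₁) (_ , a′ , u≡′ , Γ₂) =
            pow-injective i (All.lookup ps-prime p∈ps) (All.lookup ps-prime p′∈ps)
              (cong proj₁ (Γ-injective Γ₁ (subst (λ v → Γ _ (v , pow t (suc i))) (sym a≡a′) Γ₂)))
            where
              a≡a′ : a ≡ a′
              a≡a′ = ∙-cancelʳ (pow t (suc i)) a a′
                       (trans (sym (trans u≡ (Γ-product Γ₁))) (trans u≡′ (Γ-product Γ₂)))

      Ω‡≤Ω : ∀ {n n′} → HasΩ u n → HasΩ‡ u n′ → ¬ ¬ (n′ ≤ n)
      Ω‡≤Ω (ps , _ , _ , ps-complete , m , m-max , refl) (ts , unique , ts-prime , _ , m′ , m′-max , refl) =
        sum-≤-of-injection CastlesFrom unique image injective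
        where
          CastlesFrom : G → G → ℕ → Set
          CastlesFrom t p i = ∃₂ λ a w → u ≡ a · pow t (suc i) × Γ (a , pow t (suc i)) (pow p (suc i) , w)

          image : ∀ {t} i → t ∈ ts → i < m′ t → ¬ ¬ (∃[ p ] (p ∈ ps × i < m p × CastlesFrom t p i))
          image i t∈ts i<m′t with pow-‡-mono (proj₁ (All.lookup ts-prime t∈ts)) i<m′t (proj₁ (All.lookup m′-max t∈ts))
          ... | a , sa , u≡atⁱ⁺¹ = ¬¬-map castle (power-castles-left a sa)
            where
              castle : PowerCastlesLeft a → ∃[ p ] (p ∈ ps × i < m p × CastlesFrom _ p i)
              castle castles with castles (suc i) S-e S-e (All.lookup ts-prime t∈ts) (trans u≡atⁱ⁺¹ pad-with-e)
              ... | p , w , pp , Γ′ =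
                p , p∈ps , proj₂ (All.lookup m-max p∈ps) (suc i) pⁱ⁺¹∣u , a , w , u≡atⁱ⁺¹ , Γ′
                where
                  pⁱ⁺¹∣u : pow p (suc i) ∣ u
                  pⁱ⁺¹∣u = w , proj₂ (proj₂ (proj₂ (Γ⇒S Γ′))) , trans u≡atⁱ⁺¹ (Γ-product Γ′)
                  p∈ps : p ∈ ps
                  p∈ps = ps-complete p pp (pow-suc-∣⇒∣ i (proj₁ pp) pⁱ⁺¹∣u)

          injective : ∀ {t t′ p} i → t ∈ ts → t′ ∈ ts → CastlesFrom t p i → CastlesFrom t′ p i → t ≡ t′
          injective {p = p} i t∈ts t′∈ts (_ , w , u≡ , Γ₁) (_ , w′ , u≡′ , Γ₂) =
            pow-injective i (All.lookup ts-prime t∈ts) (All.lookup ts-prime t′∈ts)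
              (cong proj₂ (Γ-injective Γ₁ (subst (λ v → Γ _ (pow p (suc i) , v)) (sym w≡w′) Γ₂)))
            where
              w≡w′ : w ≡ w′
              w≡w′ = ∙-cancelˡ (pow p (suc i)) w w′
                       (trans (sym (trans u≡ (Γ-product Γ₁))) (trans u≡′ (Γ-product Γ₂)))

mainTheorem14 : (M : IntegralMonoid) → Theory.Natural M →
    (u : IntegralMonoid.G M) → IntegralMonoid.S M u → Theory.FullyCastlable M u →
    (n n' : ℕ) → Theory.HasΩ M u n → Theory.HasΩ‡ M u n' → n ≡ n'
mainTheorem14 M natural u _ fully n n' Ωu Ω‡u = decidable-stable (n ℕ.≟ n') do
  n≤n' ← Ω≤Ω‡ Ωu Ω‡u
  n'≤n ← Ω‡≤Ω Ωu Ω‡u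
  pure (≤-antisym n≤n' n'≤n)
  where open IntegralMonoidProperties.NaturalMonoidProperties.FullyCastlableProperties M natural fully
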